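{- Let $t \ge 2$ be an integer and let \[ U_t(x) = 2x^{4t-1} + x^{2t+4} - 2x^{2t+1} + 2x^{2t-1} - x^{2t-4} - 2x,\qquad W_t(x) = 2x^{4t-1} - x^{2t+4} - 2x^{2t+1} + 2x^{2t-1} + x^{2t-4} - 2x. \] For each $b \in \{3, 5, 6, 10, 15, 30\}$, the cyclotomic polynomial $\Phi_b(x)$ divides neither $U_t(x)$ nor $W_t(x)$.
   Context: $\Phi_b(x)$ denotes the $b$-th cyclotomic polynomial, $\Phi_b(x) = \prod_\zeta (x-\zeta)$ over the primitive $b$-th roots of unity $\zeta$. -}

module Defs where

open import Data.Nat using (ℕ; zero; suc; _∸_; _≡ᵇ_) renaming (_*_ to _*ℕ_; _+_ to _+ℕ_)
open import Data.Integer using (ℤ; +_; -[1+_]; _+_; _*_; -_)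
open import Data.List using (List; []; _∷_; replicate; _++_; map)
open import Data.Product using (∃)
open import Data.Bool using (if_then_else_)
open import Relation.Binary.PropositionalEquality using (_≡_)

-- Polynomials in ℤ[x] as coefficient lists, lowest degree first.
-- Two lists denote the same polynomial iff all coefficients agree
-- (trailing zeros are irrelevant).
Poly : Set
Poly = List ℤ

coeff : Poly → ℕ → ℤ
coeff []       _       = + 0
coeff (a ∷ p)  zero    = a
coeff (a ∷ p)  (suc n) = coeff p n

infixl 6 _+ₚ_
infixl 7 _*ₚ_

_+ₚ_ : Poly → Poly → Poly
[]      +ₚ q       = q
(a ∷ p) +ₚ []      = a ∷ p
(a ∷ p) +ₚ (b ∷ q) = (a + b) ∷ (p +ₚ q)

_*ₚ_ : Poly → Poly → Poly
[]      *ₚ q = []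
(a ∷ p) *ₚ q = map (a *_) q +ₚ (+ 0 ∷ (p *ₚ q))

mono : ℤ → ℕ → Poly
mono c k = replicate k (+ 0) ++ (c ∷ [])

_∣ₚ_ : Poly → Poly → Set
p ∣ₚ q = ∃ λ (r : Poly) → ∀ n → coeff q n ≡ coeff (p *ₚ r) n

U : ℕ → Poly
U t = mono (+ 2) (4 *ℕ t ∸ 1) +ₚ mono (+ 1) (2 *ℕ t +ℕ 4)
      +ₚ mono (- + 2) (2 *ℕ t +ℕ 1) +ₚ mono (+ 2) (2 *ℕ t ∸ 1)
      +ₚ mono (- + 1) (2 *ℕ t ∸ 4) +ₚ mono (- + 2) 1

W : ℕ → Poly
W t = mono (+ 2) (4 *ℕ t ∸ 1) +ₚ mono (- + 1) (2 *ℕ t +ℕ 4)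
      +ₚ mono (- + 2) (2 *ℕ t +ℕ 1) +ₚ mono (+ 2) (2 *ℕ t ∸ 1)
      +ₚ mono (+ 1) (2 *ℕ t ∸ 4) +ₚ mono (- + 2) 1

-- The cyclotomic polynomials Φ_b for the b needed here, written out explicitly
-- (coefficients lowest degree first).  Only used for b ∈ {3,5,6,10,15,30};
-- other arguments give a dummy value and never occur in the statement.
Φ : ℕ → Poly
Φ b =
  if b ≡ᵇ 3 then (+ 1 ∷ + 1 ∷ + 1 ∷ [])
  else if b ≡ᵇ 5 then (+ 1 ∷ + 1 ∷ + 1 ∷ + 1 ∷ + 1 ∷ [])
  else if b ≡ᵇ 6 then (+ 1 ∷ - + 1 ∷ + 1 ∷ [])
  else if b ≡ᵇ 10 then (+ 1 ∷ - + 1 ∷ + 1 ∷ - + 1 ∷ + 1 ∷ [])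
  else if b ≡ᵇ 15 then (+ 1 ∷ - + 1 ∷ + 0 ∷ + 1 ∷ - + 1 ∷ + 1 ∷ + 0 ∷ - + 1 ∷ + 1 ∷ [])
  else if b ≡ᵇ 30 then (+ 1 ∷ + 1 ∷ + 0 ∷ - + 1 ∷ - + 1 ∷ - + 1 ∷ + 0 ∷ + 1 ∷ + 1 ∷ [])
  else (+ 1 ∷ [])

{-# OPTIONS --safe #-}
module Submission where

-- If Φ_b ∣ U_t in ℤ[x], then m ∣ U_t(z) for every integer z with m ∣ Φ_b(z). Take z of
-- multiplicative order b modulo a prime m and P with b ∣ 2P, so that z^(2P) ≡ 1 (mod m).
-- Every exponent of U_t and W_t is 4t, 2t or 0t plus a constant, hence U_t(z) and W_t(z)
-- modulo m depend only on t mod P, and it suffices to check m ∤ U_t(z), W_t(z) for the P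
-- values t = 2, …, P + 1.

open import Defs
open import Data.Nat using (ℕ; zero; suc; _∸_; _≤_; z≤n; s≤s; NonZero) renaming (_*_ to _*ℕ_; _+_ to _+ℕ_)
import Data.Nat.Properties as ℕ
open import Data.Nat.DivMod using (_%_; _/_; m≡m%n+[m/n]*n; m%n<n)
open import Data.Fin using (Fin; toℕ; fromℕ<)
open import Data.Fin.Properties using (all?; toℕ-fromℕ<)
open import Data.List using (List; []; _∷_; map; foldl)
open import Data.List.Membership.Propositional using (_∈_)
open import Data.List.Relation.Unary.Any using (here; there)
open import Data.List.Relation.Binary.Pointwise as Pointwise using (Pointwise; []; _∷_)
open import Data.Product using (_×_; _,_; ∃)
open import Data.Integer using (ℤ; +_; _+_; _*_; -_; _-_; _^_)
open import Data.Integer.Properties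
  using ( *-distribˡ-+; *-distribʳ-+; +-identityˡ; +-identityʳ; +-assoc; *-zeroʳ; *-zeroˡ
        ; *-identityʳ; *-assoc; *-comm; +-inverseʳ; ^-distribˡ-+-*
        ; +-commutativeSemigroup; *-commutativeSemigroup )
open import Algebra.Properties.CommutativeSemigroup +-commutativeSemigroup using (interchange)
open import Algebra.Properties.CommutativeSemigroup *-commutativeSemigroup using (x∙yz≈y∙xz)
open import Data.Integer.Divisibility.Signed
  using (_∣_; divides; _∣?_; ∣-trans; ∣n⇒∣m*n; ∣m∣n⇒∣m+n; ∣m∣n⇒∣m-n)
import Data.Integer.Tactic.RingSolver as ℤ-Solver
import Data.Nat.Tactic.RingSolver as ℕ-Solver
open import Function using (_∘_)
open import Relation.Nullary using (¬_; Dec)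
open import Relation.Nullary.Decidable using (from-yes; ¬?; _×-dec_; map′)
open import Relation.Binary.PropositionalEquality using (_≡_; refl; sym; trans; cong; cong₂; subst)
open Relation.Binary.PropositionalEquality.≡-Reasoning

ev : ℤ → Poly → ℤ
ev z []      = + 0
ev z (a ∷ p) = a + z * ev z p

module _ (z : ℤ) where

  ev-+ₚ : ∀ p q → ev z (p +ₚ q) ≡ ev z p + ev z q
  ev-+ₚ []      q       = sym (+-identityˡ (ev z q))
  ev-+ₚ (a ∷ p) []      = sym (+-identityʳ (ev z (a ∷ p)))
  ev-+ₚ (a ∷ p) (b ∷ q) = begin
    (a + b) + z * ev z (p +ₚ q)           ≡⟨ cong (λ s → (a + b) + z * s) (ev-+ₚ p q) ⟩
    (a + b) + z * (ev z p + ev z q)       ≡⟨ cong (_+_ (a + b)) (*-distribˡ-+ z (ev z p) (ev z q)) ⟩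
    (a + b) + (z * ev z p + z * ev z q)   ≡⟨ interchange a b (z * ev z p) (z * ev z q) ⟩
    (a + z * ev z p) + (b + z * ev z q)   ∎

  ev-map-* : ∀ a q → ev z (map (a *_) q) ≡ a * ev z q
  ev-map-* a []      = sym (*-zeroʳ a)
  ev-map-* a (b ∷ q) = begin
    a * b + z * ev z (map (a *_) q)   ≡⟨ cong (λ s → a * b + z * s) (ev-map-* a q) ⟩
    a * b + z * (a * ev z q)          ≡⟨ cong (_+_ (a * b)) (x∙yz≈y∙xz z a (ev z q)) ⟩
    a * b + a * (z * ev z q)          ≡⟨ *-distribˡ-+ a b (z * ev z q) ⟨
    a * (b + z * ev z q)              ∎

  ev-*ₚ : ∀ p q → ev z (p *ₚ q) ≡ ev z p * ev z q
  ev-*ₚ []      q = sym (*-zeroˡ (ev z q))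
  ev-*ₚ (a ∷ p) q = begin
    ev z (map (a *_) q +ₚ (+ 0 ∷ p *ₚ q))
      ≡⟨ ev-+ₚ (map (a *_) q) (+ 0 ∷ p *ₚ q) ⟩
    ev z (map (a *_) q) + (+ 0 + z * ev z (p *ₚ q))
      ≡⟨ cong₂ (λ s r → s + (+ 0 + z * r)) (ev-map-* a q) (ev-*ₚ p q) ⟩
    a * ev z q + (+ 0 + z * (ev z p * ev z q))
      ≡⟨ cong (_+_ (a * ev z q)) (trans (+-identityˡ _) (sym (*-assoc z (ev z p) (ev z q)))) ⟩
    a * ev z q + z * ev z p * ev z q
      ≡⟨ *-distribʳ-+ (ev z q) a (z * ev z p) ⟨
    (a + z * ev z p) * ev z q
      ∎

  ev-coeff-zero : ∀ p → (∀ n → coeff p n ≡ + 0) → ev z p ≡ + 0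
  ev-coeff-zero []      _     = refl
  ev-coeff-zero (a ∷ p) zeros = begin
    a + z * ev z p    ≡⟨ cong₂ (λ b s → b + z * s) (zeros 0) (ev-coeff-zero p (zeros ∘ suc)) ⟩
    + 0 + z * + 0     ≡⟨ cong (_+_ (+ 0)) (*-zeroʳ z) ⟩
    + 0               ∎

  ev-cong : ∀ p q → (∀ n → coeff p n ≡ coeff q n) → ev z p ≡ ev z q
  ev-cong []      q       eq = sym (ev-coeff-zero q (sym ∘ eq))
  ev-cong (a ∷ p) []      eq = ev-coeff-zero (a ∷ p) eq
  ev-cong (a ∷ p) (b ∷ q) eq = cong₂ (λ c s → c + z * s) (eq 0) (ev-cong p q (eq ∘ suc))

  ev-mono : ∀ c k → ev z (mono c k) ≡ c * z ^ k
  ev-mono c zero    = trans (cong (_+_ c) (*-zeroʳ z)) (trans (+-identityʳ c) (sym (*-identityʳ c)))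
  ev-mono c (suc k) = begin
    + 0 + z * ev z (mono c k)   ≡⟨ +-identityˡ _ ⟩
    z * ev z (mono c k)         ≡⟨ cong (z *_) (ev-mono c k) ⟩
    z * (c * z ^ k)             ≡⟨ x∙yz≈y∙xz z c (z ^ k) ⟩
    c * (z * z ^ k)             ∎

  ∣ₚ⇒∣-ev : ∀ p q → p ∣ₚ q → ev z p ∣ ev z q
  ∣ₚ⇒∣-ev p q (r , q≈pr) = divides (ev z r) (begin
    ev z q             ≡⟨ ev-cong q (p *ₚ r) q≈pr ⟩
    ev z (p *ₚ r)      ≡⟨ ev-*ₚ p r ⟩
    ev z p * ev z r    ≡⟨ *-comm (ev z p) (ev z r) ⟩
    ev z r * ev z p    ∎)

addMonomial : Poly → ℤ × ℕ → Poly
addMonomial p (c , k) = p +ₚ mono c k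

-- A left fold, so that it reproduces the left-nested sums in U and W definitionally.
monomials : List (ℤ × ℕ) → Poly
monomials = foldl addMonomial []

monomialSum : ℤ → List (ℤ × ℕ) → ℤ
monomialSum z []             = + 0
monomialSum z ((c , k) ∷ cs) = c * z ^ k + monomialSum z cs

ev-foldl-addMonomial : ∀ z p cs → ev z (foldl addMonomial p cs) ≡ ev z p + monomialSum z cs
ev-foldl-addMonomial z p []             = sym (+-identityʳ (ev z p))
ev-foldl-addMonomial z p ((c , k) ∷ cs) = begin
  ev z (foldl addMonomial (p +ₚ mono c k) cs)      ≡⟨ ev-foldl-addMonomial z (p +ₚ mono c k) cs ⟩
  ev z (p +ₚ mono c k) + monomialSum z cs          ≡⟨ cong (_+ monomialSum z cs) (ev-+ₚ z p (mono c k)) ⟩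
  (ev z p + ev z (mono c k)) + monomialSum z cs    ≡⟨ cong (λ s → (ev z p + s) + monomialSum z cs) (ev-mono z c k) ⟩
  (ev z p + c * z ^ k) + monomialSum z cs          ≡⟨ +-assoc (ev z p) (c * z ^ k) (monomialSum z cs) ⟩
  ev z p + (c * z ^ k + monomialSum z cs)          ∎

ev-monomials : ∀ z cs → ev z (monomials cs) ≡ monomialSum z cs
ev-monomials z cs = trans (ev-foldl-addMonomial z [] cs) (+-identityˡ (monomialSum z cs))

∣m-m : ∀ k m → k ∣ m - m
∣m-m k m = subst (k ∣_) (sym (+-inverseʳ m)) (divides (+ 0) (sym (*-zeroˡ k)))

CongruentTerms : ℤ → ℤ → ℤ × ℕ → ℤ × ℕ → Set
CongruentTerms m z (c , k) (d , l) = c ≡ d × m ∣ z ^ l - z ^ k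

monomialSum-cong : ∀ {m z cs ds} → Pointwise (CongruentTerms m z) cs ds →
                   m ∣ monomialSum z ds - monomialSum z cs
monomialSum-cong {m} [] = ∣m-m m (+ 0)
monomialSum-cong {m} {z} {(c , k) ∷ cs} {(_ , l) ∷ ds} ((refl , zˡ≡zᵏ) ∷ rest) =
  subst (m ∣_) (regroup c (z ^ l) (z ^ k) (monomialSum z ds) (monomialSum z cs))
    (∣m∣n⇒∣m+n (∣n⇒∣m*n c zˡ≡zᵏ) (monomialSum-cong rest))
  where
  regroup : ∀ c x y s r → c * (x - y) + (s - r) ≡ (c * x + s) - (c * y + r)
  regroup = ℤ-Solver.solve-∀

ShiftedBy : ℕ → ℤ × ℕ → ℤ × ℕ → Set
ShiftedBy N (c , k) (d , l) = c ≡ d × ∃ λ j → l ≡ k +ℕ j *ℕ N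

module _ {m z : ℤ} {N : ℕ} (order : m ∣ z ^ N - + 1) where

  ^-+-period : ∀ k → m ∣ z ^ (k +ℕ N) - z ^ k
  ^-+-period k = subst (m ∣_) factor (∣n⇒∣m*n (z ^ k) order)
    where
    factor : z ^ k * (z ^ N - + 1) ≡ z ^ (k +ℕ N) - z ^ k
    factor = begin
      z ^ k * (z ^ N - + 1)     ≡⟨ distrib (z ^ k) (z ^ N) ⟩
      z ^ k * z ^ N - z ^ k     ≡⟨ cong (_- z ^ k) (^-distribˡ-+-* z k N) ⟨
      z ^ (k +ℕ N) - z ^ k      ∎
      where
      distrib : ∀ x y → x * (y - + 1) ≡ x * y - x
      distrib = ℤ-Solver.solve-∀

  ^-+-*-period : ∀ j k → m ∣ z ^ (k +ℕ j *ℕ N) - z ^ k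
  ^-+-*-period zero    k = subst (λ e → m ∣ z ^ e - z ^ k) (sym (ℕ.+-identityʳ k)) (∣m-m m (z ^ k))
  ^-+-*-period (suc j) k =
    subst (λ e → m ∣ z ^ e - z ^ k) (reassoc k j)
      (subst (m ∣_) (telescope (z ^ (k +ℕ j *ℕ N +ℕ N)) (z ^ (k +ℕ j *ℕ N)) (z ^ k))
        (∣m∣n⇒∣m+n (^-+-period (k +ℕ j *ℕ N)) (^-+-*-period j k)))
    where
    telescope : ∀ x y w → (x - y) + (y - w) ≡ x - w
    telescope = ℤ-Solver.solve-∀
    reassoc : ∀ k j → k +ℕ j *ℕ N +ℕ N ≡ k +ℕ (N +ℕ j *ℕ N)
    reassoc k j = trans (ℕ.+-assoc k (j *ℕ N) N) (cong (k +ℕ_) (ℕ.+-comm (j *ℕ N) N))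

  shifted⇒congruent : ∀ {s s'} → ShiftedBy N s s' → CongruentTerms m z s s'
  shifted⇒congruent {_ , k} (refl , j , refl) = refl , ^-+-*-period j k

module _ {m : ℤ} (f : ℕ → ℤ) (P : ℕ) .{{_ : NonZero P}} (periodic : ∀ u → m ∣ f (u +ℕ P) - f u) where

  ∣-periodic : ∀ q i → m ∣ f (i +ℕ q *ℕ P) → m ∣ f i
  ∣-periodic zero    i m∣f = subst (λ n → m ∣ f n) (ℕ.+-identityʳ i) m∣f
  ∣-periodic (suc q) i m∣f = ∣-periodic q i (subst (m ∣_) (cancel (f (j +ℕ P)) (f j))
      (∣m∣n⇒∣m-n (subst (λ n → m ∣ f n) reassoc m∣f) (periodic j)))
    where
    j : ℕ
    j = i +ℕ q *ℕ P
    reassoc : i +ℕ (P +ℕ q *ℕ P) ≡ j +ℕ P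
    reassoc = trans (cong (i +ℕ_) (ℕ.+-comm P (q *ℕ P))) (sym (ℕ.+-assoc i (q *ℕ P) P))
    cancel : ∀ x y → x - (x - y) ≡ y
    cancel = ℤ-Solver.solve-∀

  ∤-periodic : (∀ (i : Fin P) → ¬ m ∣ f (toℕ i)) → ∀ u → ¬ m ∣ f u
  ∤-periodic base u m∣f = base (fromℕ< (m%n<n u P))
    (subst (λ n → m ∣ f n) (sym (toℕ-fromℕ< (m%n<n u P)))
      (∣-periodic (u / P) (u % P) (subst (λ n → m ∣ f n) (m≡m%n+[m/n]*n u P) m∣f)))

uwTerms : ℤ → ℕ → List (ℤ × ℕ)
uwTerms ε t = (+ 2 , 4 *ℕ t ∸ 1) ∷ (ε , 2 *ℕ t +ℕ 4) ∷ (- + 2 , 2 *ℕ t +ℕ 1)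
            ∷ (+ 2 , 2 *ℕ t ∸ 1) ∷ (- ε , 2 *ℕ t ∸ 4) ∷ (- + 2 , 1) ∷ []

uwPoly : ℤ → ℕ → Poly
uwPoly ε t = monomials (uwTerms ε t)

U≡uwPoly : ∀ t → U t ≡ uwPoly (+ 1) t
U≡uwPoly t = refl

W≡uwPoly : ∀ t → W t ≡ uwPoly (- + 1) t
W≡uwPoly t = refl

uwValue : ℤ → ℤ → ℕ → ℤ
uwValue ε z t = monomialSum z (uwTerms ε t)

uwTerms-shift : ∀ ε P t → 2 ≤ t → Pointwise (ShiftedBy (2 *ℕ P)) (uwTerms ε t) (uwTerms ε (t +ℕ P))
uwTerms-shift ε P t 2≤t =
    (refl , 2 , trans (cong (_∸ 1) (×4-shift t P)) (ℕ.+-∸-comm (2 *ℕ (2 *ℕ P)) 1≤4t))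
  ∷ (refl , 1 , trans (cong (_+ℕ 4) (×2-shift t P)) (+-shift (2 *ℕ t) 4 (1 *ℕ (2 *ℕ P))))
  ∷ (refl , 1 , trans (cong (_+ℕ 1) (×2-shift t P)) (+-shift (2 *ℕ t) 1 (1 *ℕ (2 *ℕ P))))
  ∷ (refl , 1 , trans (cong (_∸ 1) (×2-shift t P)) (ℕ.+-∸-comm (1 *ℕ (2 *ℕ P)) 1≤2t))
  ∷ (refl , 1 , trans (cong (_∸ 4) (×2-shift t P)) (ℕ.+-∸-comm (1 *ℕ (2 *ℕ P)) 4≤2t))
  ∷ (refl , 0 , refl)
  ∷ []
  where
  4≤2t : 4 ≤ 2 *ℕ t
  4≤2t = ℕ.*-monoʳ-≤ 2 2≤t
  1≤t : 1 ≤ t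
  1≤t = ℕ.≤-trans (s≤s z≤n) 2≤t
  1≤2t : 1 ≤ 2 *ℕ t
  1≤2t = ℕ.≤-trans 1≤t (ℕ.m≤m+n t (1 *ℕ t))
  1≤4t : 1 ≤ 4 *ℕ t
  1≤4t = ℕ.≤-trans 1≤t (ℕ.m≤m+n t (3 *ℕ t))
  ×4-shift : ∀ t P → 4 *ℕ (t +ℕ P) ≡ 4 *ℕ t +ℕ 2 *ℕ (2 *ℕ P)
  ×4-shift = ℕ-Solver.solve-∀
  ×2-shift : ∀ t P → 2 *ℕ (t +ℕ P) ≡ 2 *ℕ t +ℕ 1 *ℕ (2 *ℕ P)
  ×2-shift = ℕ-Solver.solve-∀
  +-shift : ∀ x b y → x +ℕ y +ℕ b ≡ x +ℕ b +ℕ y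
  +-shift = ℕ-Solver.solve-∀

uwValue-periodic : ∀ {m} z P → m ∣ z ^ (2 *ℕ P) - + 1 →
                   ∀ ε t → 2 ≤ t → m ∣ uwValue ε z (t +ℕ P) - uwValue ε z t
uwValue-periodic z P order ε t 2≤t =
  monomialSum-cong (Pointwise.map (shifted⇒congruent order) (uwTerms-shift ε P t 2≤t))

¬∣ₚ-uwPoly : ∀ φ {m z} P .{{_ : NonZero P}} → m ∣ ev z φ → m ∣ z ^ (2 *ℕ P) - + 1 →
             ∀ ε → (∀ (i : Fin P) → ¬ m ∣ uwValue ε z (2 +ℕ toℕ i)) →
             ∀ t → 2 ≤ t → ¬ φ ∣ₚ uwPoly ε t
¬∣ₚ-uwPoly φ {z = z} P root order ε base (suc (suc u)) (s≤s (s≤s _)) φ∣ =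
  ∤-periodic (λ u → uwValue ε z (2 +ℕ u)) P
    (λ u → uwValue-periodic z P order ε (2 +ℕ u) (s≤s (s≤s z≤n))) base u
    (∣-trans root (subst (ev z φ ∣_) (ev-monomials z terms) (∣ₚ⇒∣-ev z φ (monomials terms) φ∣)))
  where
  terms : List (ℤ × ℕ)
  terms = uwTerms ε (2 +ℕ u)

record Certificate (φ : Poly) (m z : ℤ) (P : ℕ) : Set where
  constructor certificate
  field
    root   : m ∣ ev z φ
    order  : m ∣ z ^ (2 *ℕ P) - + 1
    U-base : ∀ (i : Fin P) → ¬ m ∣ uwValue (+ 1) z (2 +ℕ toℕ i)
    W-base : ∀ (i : Fin P) → ¬ m ∣ uwValue (- + 1) z (2 +ℕ toℕ i)

certificate? : ∀ φ m z P → Dec (Certificate φ m z P)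
certificate? φ m z P = map′ (λ (r , o , u , w) → certificate r o u w)
  (λ (certificate r o u w) → r , o , u , w)
  (m ∣? ev z φ ×-dec m ∣? z ^ (2 *ℕ P) - + 1 ×-dec
   all? (λ i → ¬? (m ∣? uwValue (+ 1) z (2 +ℕ toℕ i))) ×-dec
   all? (λ i → ¬? (m ∣? uwValue (- + 1) z (2 +ℕ toℕ i))))

certificate⇒∤U×∤W : ∀ {φ m z P} .{{_ : NonZero P}} → Certificate φ m z P →
                    ∀ t → 2 ≤ t → ¬ φ ∣ₚ U t × ¬ φ ∣ₚ W t
certificate⇒∤U×∤W {φ} {P = P} (certificate root order U-base W-base) t 2≤t =
    subst (λ p → ¬ φ ∣ₚ p) (sym (U≡uwPoly t)) (¬∣ₚ-uwPoly φ P root order (+ 1) U-base t 2≤t)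
  , subst (λ p → ¬ φ ∣ₚ p) (sym (W≡uwPoly t)) (¬∣ₚ-uwPoly φ P root order (- + 1) W-base t 2≤t)

-- z has multiplicative order b modulo the prime m, hence is a root of Φ_b modulo m,
-- and P is the least period with b ∣ 2P.
lemma17 : (t : ℕ) → 2 ≤ t → (b : ℕ) → b ∈ (3 ∷ 5 ∷ 6 ∷ 10 ∷ 15 ∷ 30 ∷ []) →
    (¬ (Φ b ∣ₚ U t)) × (¬ (Φ b ∣ₚ W t))
lemma17 t 2≤t b (here refl) =
  certificate⇒∤U×∤W (from-yes (certificate? (Φ 3) (+ 7) (+ 2) 3)) t 2≤t
lemma17 t 2≤t b (there (here refl)) =
  certificate⇒∤U×∤W (from-yes (certificate? (Φ 5) (+ 11) (+ 5) 5)) t 2≤t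
lemma17 t 2≤t b (there (there (here refl))) =
  certificate⇒∤U×∤W (from-yes (certificate? (Φ 6) (+ 7) (+ 3) 3)) t 2≤t
lemma17 t 2≤t b (there (there (there (here refl)))) =
  certificate⇒∤U×∤W (from-yes (certificate? (Φ 10) (+ 11) (+ 2) 5)) t 2≤t
lemma17 t 2≤t b (there (there (there (there (here refl))))) =
  certificate⇒∤U×∤W (from-yes (certificate? (Φ 15) (+ 31) (+ 14) 15)) t 2≤t
lemma17 t 2≤t b (there (there (there (there (there (here refl)))))) =
  certificate⇒∤U×∤W (from-yes (certificate? (Φ 30) (+ 31) (+ 11) 15)) t 2≤t
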